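{- Let $n\ge 2$ and let $f\colon\mathbb{B}^n\to\mathbb{B}^n$ be a Boolean map such that $f_n(x,0)=f_n(x,1)$ for all $x\in\mathbb{B}^{n-1}$ (equivalently, the interaction graph of $f$ has no loop at vertex $n$). Define $\tilde f\colon\mathbb{B}^{n-1}\to\mathbb{B}^{n-1}$ by $\tilde f_i(x)=f_i(x,f_n(x,0))$ for $x\in\mathbb{B}^{n-1}$, $i=1,\dots,n-1$, and let $\pi_{n-1}\colon\mathbb{B}^n\to\mathbb{B}^{n-1}$ be the projection onto the first $n-1$ coordinates. Then: (i) If $A$ is a trap space for $f$, then $\pi_{n-1}(A)$ is a trap space for $\tilde f$. (ii) If $A$ is a trap space for $\tilde f$ and $a\in\mathbb{B}$, then $A\times\{a\}$ is a trap space for $f$ if and only if $f_n(x,0)=f_n(x,1)=a$ for all $x\in A$. (iii) If $x[I]$ (with $x\in\mathbb{B}^{n-1}$, $I\subseteq\{1,\dots,n-1\}$) is a trap space for $\tilde f$, then $x[I]\times\{0,1\}$ is a trap space for $f$ if and only if $f_i(y,0)=f_i(y,1)$ for all $y\in x[I]$ and all $i\in\{1,\dots,n-1\}\setminus I$.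
   Context: $\mathbb{B}=\{0,1\}$. For $x\in\mathbb{B}^m$ and $i\in\{1,\dots,m\}$, $\bar{x}^i$ denotes $x$ with its $i$-th coordinate flipped. The asynchronous dynamics $AD_g$ of a map $g\colon\mathbb{B}^m\to\mathbb{B}^m$ is the directed graph on $\mathbb{B}^m$ with an edge $x\to\bar{x}^i$ whenever $g_i(x)\neq x_i$; the endpoints of the edges out of $x$ are the successors of $x$. For $x\in\mathbb{B}^m$ and $I\subseteq\{1,\dots,m\}$, the subspace $x[I]$ is $\{y\in\mathbb{B}^m : y_i=x_i \text{ for all } i\notin I\}$. A trap space for $g$ is a subspace $A$ such that every successor in $AD_g$ of every state of $A$ lies in $A$. The interaction graph of $f$ has a loop at $n$ iff $f_n(\bar{x}^n)\neq f_n(x)$ for some $x$. -}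

module Defs where

open import Data.Bool using (Bool; not; true; false)
open import Data.Nat using (ℕ; suc)
open import Data.Fin using (Fin; fromℕ; inject₁)
open import Data.Fin.Subset using (Subset; _∈_; _∉_)
open import Data.Vec using (Vec; lookup; tabulate; _∷ʳ_; init; _[_]%=_)
open import Data.Product using (Σ; ∃; _×_)
open import Function.Bundles using (_⇔_)
open import Relation.Binary.PropositionalEquality using (_≡_; _≢_)

𝔹^ : ℕ → Set
𝔹^ m = Vec Bool m

StateSet : ℕ → Set₁
StateSet m = 𝔹^ m → Set

flip : ∀ {m} → 𝔹^ m → Fin m → 𝔹^ m
flip x i = x [ i ]%= not

Edge : ∀ {m} → (𝔹^ m → 𝔹^ m) → 𝔹^ m → 𝔹^ m → Set
Edge g x y = Σ (Fin _) λ i → (lookup (g x) i ≢ lookup x i) × (y ≡ flip x i)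

subspace : ∀ {m} → 𝔹^ m → Subset m → StateSet m
subspace {m} x I y = ∀ (i : Fin m) → i ∉ I → lookup y i ≡ lookup x i

IsSubspace : ∀ {m} → StateSet m → Set
IsSubspace {m} A = Σ (𝔹^ m) λ x → Σ (Subset m) λ I → ∀ y → A y ⇔ subspace x I y

TrapSpace : ∀ {m} → (𝔹^ m → 𝔹^ m) → StateSet m → Set
TrapSpace g A = IsSubspace A × (∀ x y → A x → Edge g x y → A y)

π : ∀ {m} → 𝔹^ (suc m) → 𝔹^ m
π = init

image-π : ∀ {m} → StateSet (suc m) → StateSet m
image-π A x = ∃ λ y → A y × π y ≡ x

_×[_] : ∀ {m} → StateSet m → Bool → StateSet (suc m)
(A ×[ a ]) y = A (π y) × (lookup y (fromℕ _) ≡ a)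

_×𝔹 : ∀ {m} → StateSet m → StateSet (suc m)
(A ×𝔹) y = A (π y)

lastF : ∀ {m} → (𝔹^ (suc m) → 𝔹^ (suc m)) → 𝔹^ m → Bool → Bool
lastF {m} f x b = lookup (f (x ∷ʳ b)) (fromℕ m)

compF : ∀ {m} → (𝔹^ (suc m) → 𝔹^ (suc m)) → Fin m → 𝔹^ m → Bool → Bool
compF f i x b = lookup (f (x ∷ʳ b)) (inject₁ i)

reduce : ∀ {m} → (𝔹^ (suc m) → 𝔹^ (suc m)) → 𝔹^ m → 𝔹^ m
reduce f x = tabulate λ i → compF f i x (lastF f x false)

module Submission where

-- Write a state of 𝔹ⁿ as w ∷ʳ b. An edge of AD_f out of w ∷ʳ b either flips a coordinate i < n of w,
-- and is then the edge of AD_f̃ out of w whenever b = f_n(w), or flips b, which is possible exactly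
-- when b ≠ f_n(w). Without a loop at n the value f_n(w) does not depend on b, so a trap space of f
-- containing w ∷ʳ b also contains w ∷ʳ f_n(w), from which every edge of AD_f̃ out of w is mirrored;
-- this gives (i). A × {a} is closed under flipping the last coordinate iff f_n = a on A, and
-- x[I] × 𝔹 is closed under flipping a coordinate i ∉ I iff f_i ignores the last coordinate on x[I];
-- in both cases the remaining edges of AD_f are edges of AD_f̃ in disguise, giving (ii) and (iii).

open import Defs
open import Data.Bool using (Bool; true; false; not; _≟_)
open import Data.Bool.Properties using (not-¬; ¬-not)
open import Data.Empty using (⊥-elim)
open import Data.Fin using (Fin; zero; suc; fromℕ; inject₁)
open import Data.Fin.Subset using (Subset; _∈_; _∉_)
open import Data.Fin.Subset.Properties using (_∈?_)
open import Data.Nat using (ℕ; suc; _≤_)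
open import Data.Product using (_×_; _,_; proj₁; proj₂; ∃)
open import Data.Vec using (Vec; _∷_; []; lookup; _∷ʳ_; initLast; _[_]%=_; _[_]=_)
open import Data.Vec.Properties
  using ([]=⇒lookup; lookup⇒[]=; lookup∘updateAt; lookup∘updateAt′; lookup∘tabulate; init-∷ʳ)
open import Function using (_∘_)
open import Function.Bundles using (_⇔_; mk⇔; Equivalence)
open import Relation.Binary.PropositionalEquality using (_≡_; _≢_; refl; sym; trans; cong; subst)
open import Relation.Nullary using (¬_; yes; no)

open Equivalence using (to; from)

module _ {A : Set} where

  elim-∷ʳ : ∀ {n} {P : Vec A (suc n) → Set} → (∀ xs x → P (xs ∷ʳ x)) → ∀ v → P v
  elim-∷ʳ h v with initLast v
  ... | xs , x , refl = h xs x

  lookup-∷ʳ-inject₁ : ∀ {n} (xs : Vec A n) x i → lookup (xs ∷ʳ x) (inject₁ i) ≡ lookup xs i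
  lookup-∷ʳ-inject₁ (y ∷ xs) x zero    = refl
  lookup-∷ʳ-inject₁ (y ∷ xs) x (suc i) = lookup-∷ʳ-inject₁ xs x i

  lookup-∷ʳ-fromℕ : ∀ {n} (xs : Vec A n) x → lookup (xs ∷ʳ x) (fromℕ n) ≡ x
  lookup-∷ʳ-fromℕ []       x = refl
  lookup-∷ʳ-fromℕ (y ∷ xs) x = lookup-∷ʳ-fromℕ xs x

  updateAt-∷ʳ-inject₁ : ∀ {n} (xs : Vec A n) x i (g : A → A) →
                        (xs ∷ʳ x) [ inject₁ i ]%= g ≡ (xs [ i ]%= g) ∷ʳ x
  updateAt-∷ʳ-inject₁ (y ∷ xs) x zero    g = refl
  updateAt-∷ʳ-inject₁ (y ∷ xs) x (suc i) g = cong (y ∷_) (updateAt-∷ʳ-inject₁ xs x i g)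

  updateAt-∷ʳ-fromℕ : ∀ {n} (xs : Vec A n) x (g : A → A) →
                      (xs ∷ʳ x) [ fromℕ n ]%= g ≡ xs ∷ʳ g x
  updateAt-∷ʳ-fromℕ []       x g = refl
  updateAt-∷ʳ-fromℕ (y ∷ xs) x g = cong (y ∷_) (updateAt-∷ʳ-fromℕ xs x g)

  []=-∷ʳ-inject₁ : ∀ {n} {xs : Vec A n} {x y i} → (xs ∷ʳ x) [ inject₁ i ]= y ⇔ xs [ i ]= y
  []=-∷ʳ-inject₁ {xs = xs} {x} {i = i} = mk⇔
    (λ p → lookup⇒[]= i xs (trans (sym (lookup-∷ʳ-inject₁ xs x i)) ([]=⇒lookup p)))
    (λ p → lookup⇒[]= (inject₁ i) (xs ∷ʳ x)
                        (trans (lookup-∷ʳ-inject₁ xs x i) ([]=⇒lookup p)))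

  []=-∷ʳ-fromℕ : ∀ {n} {xs : Vec A n} {x y} → (xs ∷ʳ x) [ fromℕ n ]= y ⇔ x ≡ y
  []=-∷ʳ-fromℕ {n} {xs} {x} = mk⇔
    (λ p → trans (sym (lookup-∷ʳ-fromℕ xs x)) ([]=⇒lookup p))
    (λ x≡y → lookup⇒[]= (fromℕ n) (xs ∷ʳ x) (trans (lookup-∷ʳ-fromℕ xs x) x≡y))

data InjectOrLast : ∀ {m} → Fin (suc m) → Set where
  last : ∀ {m} → InjectOrLast (fromℕ m)
  inj  : ∀ {m} (i : Fin m) → InjectOrLast (inject₁ i)

injectOrLast : ∀ {m} (j : Fin (suc m)) → InjectOrLast j
injectOrLast {ℕ.zero} zero = last
injectOrLast {suc m}  zero = inj zero
injectOrLast {suc m}  (suc j) with injectOrLast j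
... | last  = last
... | inj i = inj (suc i)

constant-on-Bool : ∀ {A : Set} {g : Bool → A} → g false ≡ g true → ∀ b b′ → g b ≡ g b′
constant-on-Bool e false false = refl
constant-on-Bool e false true  = e
constant-on-Bool e true  false = sym e
constant-on-Bool e true  true  = refl

module _ {m : ℕ} where

  subspace-∷ʳ : ∀ (x : 𝔹^ m) a I p w b →
                subspace (x ∷ʳ a) (I ∷ʳ p) (w ∷ʳ b) ⇔ (subspace x I w × (p ≡ false → b ≡ a))
  subspace-∷ʳ x a I p w b = mk⇔ split join
    where
    split : subspace (x ∷ʳ a) (I ∷ʳ p) (w ∷ʳ b) → subspace x I w × (p ≡ false → b ≡ a)
    split s = (λ i i∉I → trans (sym (lookup-∷ʳ-inject₁ w b i))
                           (trans (s (inject₁ i) (i∉I ∘ to []=-∷ʳ-inject₁))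
                                  (lookup-∷ʳ-inject₁ x a i)))
            , λ { refl → trans (sym (lookup-∷ʳ-fromℕ w b))
                           (trans (s (fromℕ m) (false≢true ∘ to []=-∷ʳ-fromℕ))
                                  (lookup-∷ʳ-fromℕ x a)) }
      where
      false≢true : false ≢ true
      false≢true ()
    join : subspace x I w × (p ≡ false → b ≡ a) → subspace (x ∷ʳ a) (I ∷ʳ p) (w ∷ʳ b)
    join (s , b≡a) j j∉ with injectOrLast j
    ... | last  = trans (lookup-∷ʳ-fromℕ w b)
                    (trans (b≡a (¬-not (j∉ ∘ from []=-∷ʳ-fromℕ))) (sym (lookup-∷ʳ-fromℕ x a)))
    ... | inj i = trans (lookup-∷ʳ-inject₁ w b i)
                    (trans (s i (j∉ ∘ from []=-∷ʳ-inject₁)) (sym (lookup-∷ʳ-inject₁ x a i)))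

  flip-subspace : ∀ (x : 𝔹^ m) I w {i} → subspace x I w → i ∈ I → subspace x I (flip w i)
  flip-subspace x I w {i} s i∈I k k∉I =
    trans (lookup∘updateAt′ k i (λ { refl → k∉I i∈I }) w) (s k k∉I)

  flip-∉-subspace : ∀ (x : 𝔹^ m) I w {i} → subspace x I w → i ∉ I → ¬ subspace x I (flip w i)
  flip-∉-subspace x I w {i} s i∉I s′ =
    not-¬ refl (trans (s i i∉I) (trans (sym (s′ i i∉I)) (lookup∘updateAt i w)))

  image-π-∷ʳ : ∀ (A : StateSet (suc m)) x → image-π A x ⇔ ∃ λ b → A (x ∷ʳ b)
  image-π-∷ʳ A x = mk⇔ (λ (z , z∈A , πz≡x) → lift z z∈A πz≡x)
                       (λ (b , xb∈A) → x ∷ʳ b , xb∈A , init-∷ʳ b x)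
    where
    lift : ∀ z → A z → π z ≡ x → ∃ λ b → A (x ∷ʳ b)
    lift = elim-∷ʳ λ w b wb∈A πwb≡x →
      b , subst (λ v → A (v ∷ʳ b)) (trans (sym (init-∷ʳ b w)) πwb≡x) wb∈A

  ×[]-∷ʳ : ∀ (A : StateSet m) {a} w b → (A ×[ a ]) (w ∷ʳ b) ⇔ (A w × b ≡ a)
  ×[]-∷ʳ A w b = mk⇔
    (λ (w∈A , b≡a) → subst A (init-∷ʳ b w) w∈A , trans (sym (lookup-∷ʳ-fromℕ w b)) b≡a)
    (λ (w∈A , b≡a) → subst A (sym (init-∷ʳ b w)) w∈A , trans (lookup-∷ʳ-fromℕ w b) b≡a)

  ×𝔹-∷ʳ : ∀ (A : StateSet m) w b → (A ×𝔹) (w ∷ʳ b) ⇔ A w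
  ×𝔹-∷ʳ A w b = mk⇔ (subst A (init-∷ʳ b w)) (subst A (sym (init-∷ʳ b w)))

  image-π-isSubspace : ∀ {A : StateSet (suc m)} → IsSubspace A → IsSubspace (image-π A)
  image-π-isSubspace {A} (x , I , A⇔) with initLast x | initLast I
  ... | x′ , a , refl | I′ , p , refl = x′ , I′ , λ y → mk⇔
    (λ y∈ → let b , yb∈A = to (image-π-∷ʳ A y) y∈ in
             proj₁ (to (subspace-∷ʳ x′ a I′ p y b) (to (A⇔ _) yb∈A)))
    (λ y∈ → from (image-π-∷ʳ A y)
               (a , from (A⇔ _) (from (subspace-∷ʳ x′ a I′ p y a) (y∈ , λ _ → refl))))

  ×[]-isSubspace : ∀ {A : StateSet m} {a} → IsSubspace A → IsSubspace (A ×[ a ])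
  ×[]-isSubspace {A} {a} (x , I , A⇔) = x ∷ʳ a , I ∷ʳ false , elim-∷ʳ λ w b → mk⇔
    (λ wb∈ → let w∈A , b≡a = to (×[]-∷ʳ A w b) wb∈ in
             from (subspace-∷ʳ x a I false w b) (to (A⇔ w) w∈A , λ _ → b≡a))
    (λ wb∈ → let w∈ , b≡a = to (subspace-∷ʳ x a I false w b) wb∈ in
             from (×[]-∷ʳ A w b) (from (A⇔ w) w∈ , b≡a refl))

  ×𝔹-isSubspace : ∀ {A : StateSet m} → IsSubspace A → IsSubspace (A ×𝔹)
  ×𝔹-isSubspace {A} (x , I , A⇔) = x ∷ʳ false , I ∷ʳ true , elim-∷ʳ λ w b → mk⇔
    (λ wb∈ → from (subspace-∷ʳ x false I true w b) (to (A⇔ w) (to (×𝔹-∷ʳ A w b) wb∈) , λ ()))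
    (λ wb∈ → from (×𝔹-∷ʳ A w b)
               (from (A⇔ w) (proj₁ (to (subspace-∷ʳ x false I true w b) wb∈))))

Closed : ∀ {m} → (𝔹^ m → 𝔹^ m) → StateSet m → Set
Closed g A = ∀ x y → A x → Edge g x y → A y

module _ {m : ℕ} (f : 𝔹^ (suc m) → 𝔹^ (suc m)) where

  data Edge-∷ʳ (w : 𝔹^ m) (b : Bool) : 𝔹^ (suc m) → Set where
    inner : ∀ i → compF f i w b ≢ lookup w i → Edge-∷ʳ w b (flip w i ∷ʳ b)
    outer : lastF f w b ≢ b → Edge-∷ʳ w b (w ∷ʳ not b)

  edge-∷ʳ⁺ : ∀ {w b y} → Edge-∷ʳ w b y → Edge f (w ∷ʳ b) y
  edge-∷ʳ⁺ {w} {b} (inner i ne) =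
    inject₁ i , (λ e → ne (trans e (lookup-∷ʳ-inject₁ w b i)))
              , sym (updateAt-∷ʳ-inject₁ w b i not)
  edge-∷ʳ⁺ {w} {b} (outer ne) =
    fromℕ m , (λ e → ne (trans e (lookup-∷ʳ-fromℕ w b))) , sym (updateAt-∷ʳ-fromℕ w b not)

  edge-∷ʳ⁻ : ∀ {w b y} → Edge f (w ∷ʳ b) y → Edge-∷ʳ w b y
  edge-∷ʳ⁻ {w} {b} (j , ne , refl) with injectOrLast j
  ... | last  = subst (Edge-∷ʳ w b) (sym (updateAt-∷ʳ-fromℕ w b not))
                  (outer (λ e → ne (trans e (sym (lookup-∷ʳ-fromℕ w b)))))
  ... | inj i = subst (Edge-∷ʳ w b) (sym (updateAt-∷ʳ-inject₁ w b i not))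
                  (inner i (λ e → ne (trans e (sym (lookup-∷ʳ-inject₁ w b i)))))

  lookup-reduce : ∀ x i → lookup (reduce f x) i ≡ compF f i x (lastF f x false)
  lookup-reduce x i = lookup∘tabulate _ i

  inner⇒reduce-edge : ∀ {w b} i → compF f i w b ≡ compF f i w (lastF f w false) →
                      compF f i w b ≢ lookup w i → Edge (reduce f) w (flip w i)
  inner⇒reduce-edge {w} i same ne =
    i , (λ e → ne (trans same (trans (sym (lookup-reduce w i)) e))) , refl

  ×𝔹-closed⇒compF≡ : ∀ {A : StateSet m} {y i} b → Closed f (A ×𝔹) → A y → ¬ A (flip y i) →
                      compF f i y b ≡ lookup y i
  ×𝔹-closed⇒compF≡ {A} {y} {i} b closed y∈A flip∉A with compF f i y b ≟ lookup y i
  ... | yes e  = e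
  ... | no ne = ⊥-elim (flip∉A (to (×𝔹-∷ʳ A (flip y i) b)
                  (closed _ _ (from (×𝔹-∷ʳ A y b) y∈A) (edge-∷ʳ⁺ (inner i ne)))))

  module _ (no-loop : ∀ x → lastF f x false ≡ lastF f x true) where

    lastF-constant : ∀ x b b′ → lastF f x b ≡ lastF f x b′
    lastF-constant x = constant-on-Bool (no-loop x)

    closed⇒∷ʳ-lastF : ∀ {A : StateSet (suc m)} {w b} → Closed f A → A (w ∷ʳ b) →
                      A (w ∷ʳ lastF f w false)
    closed⇒∷ʳ-lastF {A} {w} {b} closed wb∈A with b ≟ lastF f w false
    ... | yes refl = wb∈A
    ... | no b≢c  = subst (λ c → A (w ∷ʳ c)) (sym (¬-not (b≢c ∘ sym)))
      (closed _ _ wb∈A (edge-∷ʳ⁺ (outer λ e → b≢c (trans (sym e) (lastF-constant w b false)))))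

    image-π-closed : ∀ {A : StateSet (suc m)} → Closed f A → Closed (reduce f) (image-π A)
    image-π-closed {A} closed x _ x∈ (i , ne , refl) =
      from (image-π-∷ʳ A (flip x i))
        ( lastF f x false
        , closed _ _ (closed⇒∷ʳ-lastF closed (proj₂ (to (image-π-∷ʳ A x) x∈)))
            (edge-∷ʳ⁺ (inner i (ne ∘ trans (lookup-reduce x i)))))

    ×[]-closed⇒lastF≡ : ∀ {A : StateSet m} {a x} → Closed f (A ×[ a ]) → A x →
                        (lastF f x false ≡ a) × (lastF f x true ≡ a)
    ×[]-closed⇒lastF≡ {A} {a} {x} closed x∈A with lastF f x a ≟ a
    ... | yes e  = trans (lastF-constant x false a) e , trans (lastF-constant x true a) e
    ... | no ne = ⊥-elim (not-¬ refl (sym (proj₂ (to (×[]-∷ʳ A x (not a))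
                    (closed _ _ (from (×[]-∷ʳ A x a) (x∈A , refl)) (edge-∷ʳ⁺ (outer ne)))))))

    ×[]-closed : ∀ {A : StateSet m} {a} → Closed (reduce f) A →
                 (∀ x → A x → lastF f x false ≡ a) → Closed f (A ×[ a ])
    ×[]-closed {A} {a} closed fixes = elim-∷ʳ step
      where
      step : ∀ w b y → (A ×[ a ]) (w ∷ʳ b) → Edge f (w ∷ʳ b) y → (A ×[ a ]) y
      step w b y wb∈ e with to (×[]-∷ʳ A w b) wb∈ | edge-∷ʳ⁻ e
      ... | w∈A , refl | outer ne   = ⊥-elim (ne (trans (lastF-constant w b false) (fixes w w∈A)))
      ... | w∈A , refl | inner i ne = from (×[]-∷ʳ A (flip w i) b)
        ( closed w _ w∈A (inner⇒reduce-edge i (cong (λ c → compF f i w c) (sym (fixes w w∈A))) ne)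
        , refl)

  subspace-×𝔹-closed⇒compF-constant : ∀ (x : 𝔹^ m) I → Closed f (subspace x I ×𝔹) →
    ∀ y → subspace x I y → ∀ i → i ∉ I → compF f i y false ≡ compF f i y true
  subspace-×𝔹-closed⇒compF-constant x I closed y y∈ i i∉I =
    trans (×𝔹-closed⇒compF≡ false closed y∈ (flip-∉-subspace x I y y∈ i∉I))
          (sym (×𝔹-closed⇒compF≡ true closed y∈ (flip-∉-subspace x I y y∈ i∉I)))

  subspace-×𝔹-closed : ∀ (x : 𝔹^ m) I → Closed (reduce f) (subspace x I) →
    (∀ y → subspace x I y → ∀ i → i ∉ I → compF f i y false ≡ compF f i y true) →
    Closed f (subspace x I ×𝔹)
  subspace-×𝔹-closed x I closed constant = elim-∷ʳ step
    where
    S : StateSet m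
    S = subspace x I
    step : ∀ w b y → (S ×𝔹) (w ∷ʳ b) → Edge f (w ∷ʳ b) y → (S ×𝔹) y
    step w b y wb∈ e with to (×𝔹-∷ʳ S w b) wb∈ | edge-∷ʳ⁻ e
    ... | w∈S | outer _    = from (×𝔹-∷ʳ S w (not b)) w∈S
    ... | w∈S | inner i ne with i ∈? I
    ...   | yes i∈I = from (×𝔹-∷ʳ S (flip w i) b) (flip-subspace x I w w∈S i∈I)
    ...   | no i∉I  = from (×𝔹-∷ʳ S (flip w i) b) (closed w _ w∈S
      (inner⇒reduce-edge i (constant-on-Bool (constant w w∈S i i∉I) b (lastF f w false)) ne))

proposition1 : (m : ℕ) → 2 ≤ suc m → (f : 𝔹^ (suc m) → 𝔹^ (suc m))
    → (∀ x → lastF f x false ≡ lastF f x true)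
    → ((A : StateSet (suc m)) → TrapSpace f A → TrapSpace (reduce f) (image-π A))
    × ((A : StateSet m) → TrapSpace (reduce f) A → (a : Bool)
        → TrapSpace f (A ×[ a ])
          ⇔ (∀ x → A x → (lastF f x false ≡ a) × (lastF f x true ≡ a)))
    × ((x : 𝔹^ m) (I : Subset m) → TrapSpace (reduce f) (subspace x I)
        → TrapSpace f (subspace x I ×𝔹)
          ⇔ (∀ y → subspace x I y → (i : Fin m) → i ∉ I
              → compF f i y false ≡ compF f i y true))
proposition1 m _ f no-loop =
    (λ A (sub , closed) → image-π-isSubspace sub , image-π-closed f no-loop closed)
  , (λ A (sub , closed) a → mk⇔
      (λ (_ , closed×) x x∈A → ×[]-closed⇒lastF≡ f no-loop closed× x∈A)
      (λ fixes → ×[]-isSubspace sub , ×[]-closed f no-loop closed (λ x → proj₁ ∘ fixes x)))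
  , (λ x I (sub , closed) → mk⇔
      (λ (_ , closed×) → subspace-×𝔹-closed⇒compF-constant f x I closed×)
      (λ constant → ×𝔹-isSubspace sub , subspace-×𝔹-closed f x I closed constant))
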